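{- Let $\Gamma$ be an infinite discrete abelian group with identity $e_\Gamma$, and let $S=\{s_1,\ldots,s_k\}\subset\Gamma$ be a finite set with $e_\Gamma\notin S$, $\langle S\rangle=\Gamma$ and $S=S^{ -1}$. Let $G=\mathrm{Cay}(\Gamma,S)$. Then for every $f\in L^2(\Gamma)$ the combinatorial heat equation $$\Delta_G u(x,n)+\partial_n u(x,n)=0 \text{ on } \Gamma\times\mathbb Z_+,\qquad u(x,0)=f(x),$$ admits a unique solution, given by $u(x,n)=K_n*f(x)$, where $$K_n(x)=\chi_{\{e_\Gamma\}}(x)+\sum_{j=1}^n(-1)^j\binom{n}{j}\underbrace{h*\cdots*h}_{j\text{ times}}(x),\qquad h(x)=|S|\,\chi_{\{e_\Gamma\}}(x)-\chi_B(x),$$ and $B\subset\Gamma$ is the boundary of the unit ball centered at $e_\Gamma$ in $G$ (i.e. $B=\{x: d_G(x,e_\Gamma)=1\}=S$).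
   Context: For a connected locally finite graph $G=(V,E)$, the combinatorial Laplacian is $\Delta_G f(x)=m(x)f(x)-\sum_{y\sim x}f(y)$, where $m(x)$ is the degree of $x$; $d_G$ is the graph (shortest path) distance. The Cayley graph $\mathrm{Cay}(\Gamma,S)$ has vertex set $\Gamma$ and edges $\{x,xs\}$ for $x\in\Gamma$, $s\in S$. $\mathbb Z_+=\{0,1,2,\ldots\}$ and for $v:\mathbb Z_+\to\mathbb C$, $\partial_n v(n)=v(n+1)-v(n)$ (applied in the time variable). $L^p(\Gamma)$ is the space of $f:\Gamma\to\mathbb C$ with $\sum_{x\in\Gamma}|f(x)|^p<\infty$. Convolution: $f*g(x)=\sum_{y\in\Gamma}f(y)g(xy^{ -1})$. $\chi_A$ is the indicator function of $A$. -}

module Defs where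

open import Level using (Level; _⊔_)
open import Data.Nat using (ℕ; zero; suc)
open import Data.Nat.Combinatorics using (_C_)
open import Data.List using (List; []; _∷_; map; foldr; concatMap; length; upTo; _++_)
open import Data.List.Relation.Unary.All using (All)
open import Data.List.Relation.Unary.Any using (Any)
open import Data.List.Relation.Unary.AllPairs using (AllPairs)
open import Data.Product using (_×_; _,_; Σ; ∃)
open import Relation.Nullary using (¬_)
open import Function.Bundles using (_⇔_)
open import Algebra.Bundles using (AbelianGroup; CommutativeRing)

-- Everything is relative to an abelian group Γ (written multiplicatively
-- via the bundle's _∙_, ε, _⁻¹, with setoid equality _≈_) and a
-- commutative coefficient ring R (the paper uses R = ℂ).
module HeatDefs {a b c d : Level} (Γ : AbelianGroup a b) (R : CommutativeRing c d) where

  open AbelianGroup Γ public using () renaming (Carrier to G; _≈_ to _≈G_; _∙_ to _·_; ε to e; _⁻¹ to inv)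
  open CommutativeRing R public using () renaming (Carrier to K; _≈_ to _≈R_; _+_ to _+R_; _*_ to _*R_;
                                   -_ to negR; 0# to 0R; 1# to 1R)

  ΣR : List K → K
  ΣR = foldr _+R_ 0R

  natR : ℕ → K
  natR zero = 0R
  natR (suc n) = 1R +R natR n

  sgn : ℕ → K
  sgn zero = 1R
  sgn (suc j) = negR (sgn j)

  Infinite : Set (a ⊔ b)
  Infinite = (xs : List G) → ∃ λ x → All (λ y → ¬ (x ≈G y)) xs

  prod : List G → G
  prod = foldr _·_ e

  Generates : List G → Set (a ⊔ b)
  Generates S = (x : G) → ∃ λ (w : List G) → All (λ s → Any (s ≈G_) S) w × (prod w ≈G x)

  Symmetric : List G → Set (a ⊔ b)
  Symmetric S = All (λ s → Any (inv s ≈G_) S) S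

  NoIdentity : List G → Set (a ⊔ b)
  NoIdentity S = All (λ s → ¬ (s ≈G e)) S

  -- S is given as a list without repetitions, so |S| = length S
  Distinct : List G → Set (a ⊔ b)
  Distinct S = AllPairs (λ s t → ¬ (s ≈G t)) S

  -- Combinatorial Laplacian of G = Cay(Γ,S):
  -- the neighbours of x are x·s (s ∈ S), and the degree is m(x) = |S|.
  Δ : List G → (G → K) → G → K
  Δ S f x = (natR (length S) *R f x) +R negR (ΣR (map (λ s → f (x · s)) S))

  IsHeatSolution : List G → (G → K) → (G → ℕ → K) → Set (a ⊔ d)
  IsHeatSolution S f u =
    ((x : G) (n : ℕ) → (Δ S (λ y → u y n) x +R (u x (suc n) +R negR (u x n))) ≈R 0R)
    × ((x : G) → u x 0 ≈R f x)

  -- Finitely supported functions Γ → R as formal sums Σ c_i χ_{g_i}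
  FinSupp : Set (a ⊔ c)
  FinSupp = List (G × K)

  -- value of a formal sum at x (needs decidable equality; not needed below,
  -- convolution is defined directly on formal sums)

  -- convolution of finitely supported functions:
  -- (c₁χ_{g₁}) * (c₂χ_{g₂}) = c₁c₂ χ_{g₁g₂}
  _⊛_ : FinSupp → FinSupp → FinSupp
  φ ⊛ ψ = concatMap (λ { (g , α) → map (λ { (h , β) → (g · h , α *R β) }) ψ }) φ

  scale : K → FinSupp → FinSupp
  scale λ' = map (λ { (g , α) → (g , λ' *R α) })

  conv : FinSupp → (G → K) → G → K
  conv φ f x = ΣR (map (λ { (y , α) → α *R f (x · inv y) }) φ)

  δe : FinSupp
  δe = (e , 1R) ∷ []

  hker : List G → FinSupp
  hker S = (e , natR (length S)) ∷ map (λ s → (s , negR 1R)) S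

  hpow : List G → ℕ → FinSupp
  hpow S zero = δe
  hpow S (suc zero) = hker S
  hpow S (suc (suc j)) = hker S ⊛ hpow S (suc j)

  Kn : List G → ℕ → FinSupp
  Kn S n = δe ++ concatMap (λ i → scale (sgn (suc i) *R natR (n C suc i)) (hpow S (suc i))) (upTo n)

module Submission where

-- Write T g = h * g for the convolution with h = |S| δ_e − χ_S.  The
-- heat equation Δu(n) + ∂ₙu(n) = 0 is the explicit scheme
-- u(n+1) = u(n) − Δu(n), so it has exactly one solution with u(0) = f,
-- namely the sequence V obeying that recursion (DifferenceEquation).
-- It remains to see that V(n) = K_n * f obeys it:
--   * convolution is linear and associative, (φ ⊛ ψ) * f = φ * (ψ * f),
--     so h^{*j} * f = Tʲ f and K_n * f = Σᵢ (−1)ⁱ C(n,i) Tⁱ f = (1 − T)ⁿ f;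
--   * Pascal's rule gives (1 − T)ⁿ⁺¹ f = (1 − T)ⁿ f − T (1 − T)ⁿ f;
--   * for S = S⁻¹ without repetitions, inversion permutes S, so
--     T g(x) = |S| g(x) − Σ_s g(x s⁻¹) equals Δ g(x) = |S| g(x) − Σ_s g(x s).

open import Defs
open import Level using (Level; _⊔_)
open import Data.Nat using (ℕ)
open import Data.List using (List)
open import Data.Product using (_×_)
open import Function.Bundles using (_⇔_)
open import Algebra.Bundles using (AbelianGroup; CommutativeRing)

open import Data.Nat as ℕ using (zero; suc)
open import Data.Nat.Properties using (n<1+n)
open import Data.Nat.Combinatorics using (_C_; nCk+nC[k+1]≡[n+1]C[k+1]; k>n⇒nCk≡0)
open import Data.List using ([]; _∷_; map; foldr; concatMap; length; upTo; _++_; applyUpTo)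
open import Data.List.Properties using (map-∘)
open import Data.List.Relation.Unary.Any using (here; there)
open import Data.List.Relation.Unary.All using (lookupₛ)
open import Data.List.Relation.Unary.All.Properties using (─⁺)
open import Data.List.Relation.Unary.AllPairs using (_∷_)
open import Data.Product using (_,_)
open import Data.Empty using (⊥-elim)
open import Function.Base using (id)
open import Function.Bundles using (mk⇔)
open import Relation.Binary.Bundles using (Setoid)
open import Relation.Binary.PropositionalEquality as ≡ using (_≡_)
open import Algebra.Bundles using (CommutativeMonoid)
import Data.List.Membership.Setoid as Membership
open import Data.List.Membership.Setoid.Properties using (∈-resp-≈; All[≉]⇒∉; ∈-map⁺; ∈-map⁻)
import Data.List.Relation.Unary.Unique.Setoid as UniqueSetoid
import Data.List.Relation.Unary.Unique.Setoid.Properties as UniqueProps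
import Algebra.Properties.CommutativeSemigroup as CommSemigroupProps
import Algebra.Properties.Ring as RingProps
import Algebra.Properties.Group as GroupProps
import Algebra.Properties.AbelianGroup as AbelianGroupProps
import Relation.Binary.Reasoning.Setoid as SetoidReasoning

module DuplicateFreeSums {a ℓ c ℓ′} (A : Setoid a ℓ) (M : CommutativeMonoid c ℓ′) where
  open Setoid A using (_≉_) renaming (Carrier to X; _≈_ to _≈A_; sym to symA; trans to transA)
  open CommutativeMonoid M hiding (_≉_)
  open CommSemigroupProps commutativeSemigroup using (x∙yz≈y∙xz)
  open Membership A using (_∈_; _─_)
  open UniqueSetoid A using (Unique)

  sumOf : (X → Carrier) → List X → Carrier
  sumOf φ xs = foldr _∙_ ε (map φ xs)

  ∈-─⁻ : ∀ {z x} (xs : List X) (p : z ∈ xs) → x ∈ xs ─ p → x ∈ xs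
  ∈-─⁻ (y ∷ xs) (here _)  q         = there q
  ∈-─⁻ (y ∷ xs) (there p) (here q)  = here q
  ∈-─⁻ (y ∷ xs) (there p) (there q) = there (∈-─⁻ xs p q)

  ∈-─⁺ : ∀ {z x} (xs : List X) (p : z ∈ xs) → x ∈ xs → x ≉ z → x ∈ xs ─ p
  ∈-─⁺ (y ∷ xs) (here z≈y) (here x≈y)  x≉z = ⊥-elim (x≉z (transA x≈y (symA z≈y)))
  ∈-─⁺ (y ∷ xs) (here _)   (there q)   x≉z = q
  ∈-─⁺ (y ∷ xs) (there p)  (here x≈y)  x≉z = here x≈y
  ∈-─⁺ (y ∷ xs) (there p)  (there q)   x≉z = there (∈-─⁺ xs p q x≉z)

  removed-≉ : ∀ {z x} (xs : List X) (p : z ∈ xs) → Unique xs → x ∈ xs ─ p → x ≉ z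
  removed-≉ (y ∷ xs) (here z≈y) (y∉xs ∷ _) q x≈z =
    All[≉]⇒∉ A y∉xs (∈-resp-≈ A (transA x≈z z≈y) q)
  removed-≉ (y ∷ xs) (there p)  (y∉xs ∷ _) (here x≈y) x≈z =
    All[≉]⇒∉ A y∉xs (∈-resp-≈ A (transA (symA x≈z) x≈y) p)
  removed-≉ (y ∷ xs) (there p)  (_ ∷ !xs)  (there q)  x≈z = removed-≉ xs p !xs q x≈z

  unique-─ : ∀ {z} (xs : List X) (p : z ∈ xs) → Unique xs → Unique (xs ─ p)
  unique-─ (y ∷ xs) (here _)  (_ ∷ !xs)    = !xs
  unique-─ (y ∷ xs) (there p) (y∉xs ∷ !xs) = ─⁺ p y∉xs ∷ unique-─ xs p !xs

  module _ (φ : X → Carrier) (φ-cong : ∀ {x y} → x ≈A y → φ x ≈ φ y) where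

    sumOf-─ : ∀ {z} (xs : List X) (p : z ∈ xs) → sumOf φ xs ≈ φ z ∙ sumOf φ (xs ─ p)
    sumOf-─ (y ∷ xs) (here z≈y) = ∙-congʳ (φ-cong (symA z≈y))
    sumOf-─ (y ∷ xs) (there p)  = trans (∙-congˡ (sumOf-─ xs p)) (x∙yz≈y∙xz _ _ _)

    sumOf-sameElements : (xs ys : List X) → Unique xs → Unique ys →
      (∀ {x} → x ∈ xs → x ∈ ys) → (∀ {x} → x ∈ ys → x ∈ xs) →
      sumOf φ xs ≈ sumOf φ ys
    sumOf-sameElements []       []       _ _ _     _     = refl
    sumOf-sameElements []       (y ∷ ys) _ _ _     ys⊆xs with () ← ys⊆xs (here (Setoid.refl A))
    sumOf-sameElements (x ∷ xs) ys (x∉xs ∷ !xs) !ys xs⊆ys ys⊆xs =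
      trans (∙-congˡ (sumOf-sameElements xs (ys ─ p) !xs (unique-─ ys p !ys) xs⊆ys─p ys─p⊆xs))
            (sym (sumOf-─ ys p))
      where
      p : x ∈ ys
      p = xs⊆ys (here (Setoid.refl A))
      xs⊆ys─p : ∀ {w} → w ∈ xs → w ∈ ys ─ p
      xs⊆ys─p q = ∈-─⁺ ys p (xs⊆ys (there q)) (λ w≈x → All[≉]⇒∉ A x∉xs (∈-resp-≈ A w≈x q))
      ys─p⊆xs : ∀ {w} → w ∈ ys ─ p → w ∈ xs
      ys─p⊆xs q with ys⊆xs (∈-─⁻ ys p q)
      ... | here w≈x = ⊥-elim (removed-≉ ys p !ys q w≈x)
      ... | there q′ = q′

module HeatEquation {a b c d : Level} (Γ : AbelianGroup a b) (R : CommutativeRing c d) where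
  open HeatDefs Γ R
  module Grp = AbelianGroup Γ
  open CommutativeRing R hiding (zero)
  open RingProps ring using (-0#≈0#; +-inverseʳ-unique; -‿+-comm; -‿distribˡ-*; -1*x≈-x)
  open CommSemigroupProps +-commutativeSemigroup using (interchange; xy∙z≈y∙xz)
  open CommSemigroupProps *-commutativeSemigroup using () renaming (x∙yz≈y∙xz to x*yz≈y*xz)
  open GroupProps Grp.group using (ε⁻¹≈ε; ⁻¹-involutive; ⁻¹-injective)
  open AbelianGroupProps Γ using (⁻¹-∙-comm)
  open Membership Grp.setoid using (_∈_)
  open SetoidReasoning setoid

  step-forced : ∀ {l v w} → l + (w + - v) ≈ 0# → w ≈ v + - l
  step-forced {l} {v} {w} eq = begin
    w               ≈⟨ +-identityʳ w ⟨
    w + 0#          ≈⟨ +-congˡ (-‿inverseˡ v) ⟨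
    w + (- v + v)   ≈⟨ +-assoc w (- v) v ⟨
    (w + - v) + v   ≈⟨ +-congʳ (+-inverseʳ-unique l (w + - v) eq) ⟩
    - l + v         ≈⟨ +-comm (- l) v ⟩
    v + - l         ∎

  step-solves : ∀ l v → l + ((v + - l) + - v) ≈ 0#
  step-solves l v = begin
    l + ((v + - l) + - v)   ≈⟨ +-congˡ (xy∙z≈y∙xz v (- l) (- v)) ⟩
    l + (- l + (v + - v))   ≈⟨ +-congˡ (+-congˡ (-‿inverseʳ v)) ⟩
    l + (- l + 0#)          ≈⟨ +-congˡ (+-identityʳ (- l)) ⟩
    l + - l                 ≈⟨ -‿inverseʳ l ⟩
    0#                      ∎

  module DifferenceEquation {ℓ} {X : Set ℓ} (L : (X → K) → X → K)
    (L-ext : ∀ {g g′} → (∀ y → g y ≈ g′ y) → ∀ x → L g x ≈ L g′ x)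
    (f : X → K) (V : ℕ → X → K)
    (V-initial : ∀ x → V 0 x ≈ f x)
    (V-step : ∀ n x → V (suc n) x ≈ V n x + - L (V n) x) where

    Solves : (X → ℕ → K) → Set (ℓ ⊔ d)
    Solves u = ((x : X) (n : ℕ) → L (λ y → u y n) x + (u x (suc n) + - u x n) ≈ 0#)
             × ((x : X) → u x 0 ≈ f x)

    solution-is-V : ∀ {u} → Solves u → ∀ x n → u x n ≈ V n x
    solution-is-V (_ , initial) x zero = trans (initial x) (sym (V-initial x))
    solution-is-V {u} sol@(equation , _) x (suc n) = begin
      u x (suc n)                  ≈⟨ step-forced (equation x n) ⟩
      u x n + - L (λ y → u y n) x  ≈⟨ +-cong (solution-is-V sol x n) (-‿cong (L-ext (λ y → solution-is-V sol y n) x)) ⟩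
      V n x + - L (V n) x          ≈⟨ V-step n x ⟨
      V (suc n) x                  ∎

    V-solves : ∀ {u} → (∀ x n → u x n ≈ V n x) → Solves u
    V-solves {u} u≈V = equation , λ x → trans (u≈V x 0) (V-initial x)
      where
      equation : ∀ x n → L (λ y → u y n) x + (u x (suc n) + - u x n) ≈ 0#
      equation x n = begin
        L (λ y → u y n) x + (u x (suc n) + - u x n)  ≈⟨ +-cong (L-ext (λ y → u≈V y n) x) (+-cong (trans (u≈V x (suc n)) (V-step n x)) (-‿cong (u≈V x n))) ⟩
        L (V n) x + ((V n x + - L (V n) x) + - V n x) ≈⟨ step-solves (L (V n) x) (V n x) ⟩
        0#                                           ∎

    solves⇔V : ∀ u → Solves u ⇔ (∀ x n → u x n ≈ V n x)
    solves⇔V u = mk⇔ solution-is-V V-solves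

  natR-+ : ∀ m n → natR (m ℕ.+ n) ≈ natR m + natR n
  natR-+ zero    n = sym (+-identityˡ (natR n))
  natR-+ (suc m) n = trans (+-congˡ (natR-+ m n)) (sym (+-assoc 1# (natR m) (natR n)))

  ΣR-cong : ∀ {ℓ} {X : Set ℓ} (xs : List X) {A B : X → K} → (∀ x → A x ≈ B x) → ΣR (map A xs) ≈ ΣR (map B xs)
  ΣR-cong []       A≈B = refl
  ΣR-cong (x ∷ xs) A≈B = +-cong (A≈B x) (ΣR-cong xs A≈B)

  sumTo : ℕ → (ℕ → K) → K
  sumTo m A = ΣR (applyUpTo A m)

  map-applyUpTo : ∀ {ℓ} {X : Set ℓ} (F : ℕ → X) (A : ℕ → ℕ) m → map F (applyUpTo A m) ≡ applyUpTo (λ i → F (A i)) m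
  map-applyUpTo F A zero    = ≡.refl
  map-applyUpTo F A (suc m) = ≡.cong (F (A 0) ∷_) (map-applyUpTo F (λ i → A (suc i)) m)

  sumTo-cong : ∀ m {A B : ℕ → K} → (∀ i → A i ≈ B i) → sumTo m A ≈ sumTo m B
  sumTo-cong zero    A≈B = refl
  sumTo-cong (suc m) A≈B = +-cong (A≈B 0) (sumTo-cong m (λ i → A≈B (suc i)))

  sumTo-last : ∀ m (A : ℕ → K) → sumTo (suc m) A ≈ sumTo m A + A m
  sumTo-last zero    A = trans (+-identityʳ (A 0)) (sym (+-identityˡ (A 0)))
  sumTo-last (suc m) A = begin
    A 0 + sumTo (suc m) (λ i → A (suc i))          ≈⟨ +-congˡ (sumTo-last m (λ i → A (suc i))) ⟩
    A 0 + (sumTo m (λ i → A (suc i)) + A (suc m))  ≈⟨ +-assoc (A 0) _ (A (suc m)) ⟨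
    (A 0 + sumTo m (λ i → A (suc i))) + A (suc m)  ∎

  sumTo-sub : ∀ m (A B : ℕ → K) → sumTo m (λ i → A i + - B i) ≈ sumTo m A + - sumTo m B
  sumTo-sub zero    A B = sym (trans (+-congˡ -0#≈0#) (+-identityʳ 0#))
  sumTo-sub (suc m) A B = begin
    (A 0 + - B 0) + sumTo m (λ i → A (suc i) + - B (suc i))                      ≈⟨ +-congˡ (sumTo-sub m (λ i → A (suc i)) (λ i → B (suc i))) ⟩
    (A 0 + - B 0) + (sumTo m (λ i → A (suc i)) + - sumTo m (λ i → B (suc i)))    ≈⟨ interchange (A 0) (- B 0) _ _ ⟩
    (A 0 + sumTo m (λ i → A (suc i))) + (- B 0 + - sumTo m (λ i → B (suc i)))    ≈⟨ +-congˡ (-‿+-comm (B 0) _) ⟩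
    sumTo (suc m) A + - sumTo (suc m) B                                           ∎

  conv-ext : ∀ (φ : FinSupp) {g g′ : G → K} → (∀ y → g y ≈ g′ y) → ∀ x → conv φ g x ≈ conv φ g′ x
  conv-ext []            g≈g′ x = refl
  conv-ext ((y , α) ∷ φ) g≈g′ x = +-cong (*-congˡ (g≈g′ (x · inv y))) (conv-ext φ g≈g′ x)

  conv-resp : ∀ (φ : FinSupp) {g : G → K} → (∀ {x y} → x ≈G y → g x ≈ g y) →
    ∀ {x x′} → x ≈G x′ → conv φ g x ≈ conv φ g x′
  conv-resp []            g-cong x≈x′ = refl
  conv-resp ((y , α) ∷ φ) g-cong x≈x′ = +-cong (*-congˡ (g-cong (Grp.∙-congʳ x≈x′))) (conv-resp φ g-cong x≈x′)

  conv-+ : ∀ (φ : FinSupp) (g g′ : G → K) x → conv φ (λ y → g y + g′ y) x ≈ conv φ g x + conv φ g′ x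
  conv-+ []            g g′ x = sym (+-identityʳ 0#)
  conv-+ ((y , α) ∷ φ) g g′ x = trans (+-cong (distribˡ α _ _) (conv-+ φ g g′ x)) (interchange _ _ _ _)

  conv-* : ∀ (φ : FinSupp) k (g : G → K) x → conv φ (λ y → k * g y) x ≈ k * conv φ g x
  conv-* []            k g x = sym (zeroʳ k)
  conv-* ((y , α) ∷ φ) k g x = begin
    α * (k * g (x · inv y)) + conv φ (λ y → k * g y) x  ≈⟨ +-cong (x*yz≈y*xz α k _) (conv-* φ k g x) ⟩
    k * (α * g (x · inv y)) + k * conv φ g x            ≈⟨ distribˡ k _ _ ⟨
    k * conv ((y , α) ∷ φ) g x                          ∎

  conv-0 : ∀ (φ : FinSupp) x → conv φ (λ _ → 0#) x ≈ 0#
  conv-0 []            x = refl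
  conv-0 ((y , α) ∷ φ) x = trans (+-cong (zeroʳ α) (conv-0 φ x)) (+-identityʳ 0#)

  conv-linear : ∀ (φ : FinSupp) m (c : ℕ → K) (A : ℕ → G → K) x →
    conv φ (λ y → sumTo m (λ i → c i * A i y)) x ≈ sumTo m (λ i → c i * conv φ (A i) x)
  conv-linear φ zero    c A x = conv-0 φ x
  conv-linear φ (suc m) c A x = begin
    conv φ (λ y → c 0 * A 0 y + sumTo m (λ i → c (suc i) * A (suc i) y)) x
      ≈⟨ conv-+ φ (λ y → c 0 * A 0 y) (λ y → sumTo m (λ i → c (suc i) * A (suc i) y)) x ⟩
    conv φ (λ y → c 0 * A 0 y) x + conv φ (λ y → sumTo m (λ i → c (suc i) * A (suc i) y)) x
      ≈⟨ +-cong (conv-* φ (c 0) (A 0) x) (conv-linear φ m (λ i → c (suc i)) (λ i → A (suc i)) x) ⟩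
    sumTo (suc m) (λ i → c i * conv φ (A i) x) ∎

  conv-++ : ∀ (φ ψ : FinSupp) g x → conv (φ ++ ψ) g x ≈ conv φ g x + conv ψ g x
  conv-++ []            ψ g x = sym (+-identityˡ _)
  conv-++ ((y , α) ∷ φ) ψ g x = trans (+-congˡ (conv-++ φ ψ g x)) (sym (+-assoc _ _ _))

  conv-scale : ∀ k (φ : FinSupp) g x → conv (scale k φ) g x ≈ k * conv φ g x
  conv-scale k []            g x = sym (zeroʳ k)
  conv-scale k ((y , α) ∷ φ) g x = trans (+-cong (*-assoc k α _) (conv-scale k φ g x)) (sym (distribˡ k _ _))

  conv-concatMap : ∀ {ℓ} {X : Set ℓ} (F : X → FinSupp) (xs : List X) g x →
    conv (concatMap F xs) g x ≈ ΣR (map (λ i → conv (F i) g x) xs)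
  conv-concatMap F []       g x = refl
  conv-concatMap F (i ∷ xs) g x = trans (conv-++ (F i) (concatMap F xs) g x) (+-congˡ (conv-concatMap F xs g x))

  x·e⁻¹≈x : ∀ x → x · inv e ≈G x
  x·e⁻¹≈x x = Grp.trans (Grp.∙-congˡ ε⁻¹≈ε) (Grp.identityʳ x)

  conv-δe : ∀ {g : G → K} → (∀ {x y} → x ≈G y → g x ≈ g y) → ∀ x → conv δe g x ≈ g x
  conv-δe g-cong x = trans (+-identityʳ _) (trans (*-identityˡ _) (g-cong (x·e⁻¹≈x x)))

  module _ {g : G → K} (g-cong : ∀ {x y} → x ≈G y → g x ≈ g y) where

    conv-translate : ∀ (ψ : FinSupp) u α (M : G × K → G × K) → (∀ v β → M (v , β) ≡ (u · v , α * β)) →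
      ∀ x → conv (map M ψ) g x ≈ α * conv ψ g (x · inv u)
    conv-translate []            u α M M≡ x = sym (zeroʳ α)
    conv-translate ((v , β) ∷ ψ) u α M M≡ x rewrite M≡ v β =
      trans (+-cong summand (conv-translate ψ u α M M≡ x)) (sym (distribˡ α _ _))
      where
      x[uv]⁻¹≈xu⁻¹v⁻¹ : x · inv (u · v) ≈G (x · inv u) · inv v
      x[uv]⁻¹≈xu⁻¹v⁻¹ = Grp.trans (Grp.∙-congˡ (Grp.sym (⁻¹-∙-comm u v))) (Grp.sym (Grp.assoc x (inv u) (inv v)))
      summand : (α * β) * g (x · inv (u · v)) ≈ α * (β * g ((x · inv u) · inv v))
      summand = trans (*-assoc α β _) (*-congˡ (*-congˡ (g-cong x[uv]⁻¹≈xu⁻¹v⁻¹)))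

    conv-⊛ : ∀ (φ ψ : FinSupp) x → conv (φ ⊛ ψ) g x ≈ conv φ (conv ψ g) x
    conv-⊛ []            ψ x = refl
    conv-⊛ ((u , α) ∷ φ) ψ x =
      trans (conv-++ (map _ ψ) (φ ⊛ ψ) g x)
            (+-cong (conv-translate ψ u α _ (λ v β → ≡.refl) x) (conv-⊛ φ ψ x))

  -- For a symmetric duplicate-free S, inversion permutes S, so a sum over S
  -- may be re-indexed by s ↦ s⁻¹.
  module SymmetricSet (S : List G) (distinct : Distinct S) (symmetric : Symmetric S) where
    open DuplicateFreeSums Grp.setoid +-commutativeMonoid using (sumOf-sameElements)

    inv-∈ : ∀ {x} → x ∈ S → inv x ∈ S
    inv-∈ = lookupₛ Grp.setoid (λ x≈y → ∈-resp-≈ Grp.setoid (Grp.⁻¹-cong x≈y)) symmetric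

    inverses⊆S : ∀ {x} → x ∈ map inv S → x ∈ S
    inverses⊆S x∈S⁻¹ with s , s∈S , x≈s⁻¹ ← ∈-map⁻ Grp.setoid Grp.setoid x∈S⁻¹ =
      ∈-resp-≈ Grp.setoid (Grp.sym x≈s⁻¹) (inv-∈ s∈S)

    S⊆inverses : ∀ {x} → x ∈ S → x ∈ map inv S
    S⊆inverses {x} x∈S = ∈-resp-≈ Grp.setoid (⁻¹-involutive x)
                           (∈-map⁺ Grp.setoid Grp.setoid Grp.⁻¹-cong (inv-∈ x∈S))

    sum-over-inverses : (φ : G → K) → (∀ {x y} → x ≈G y → φ x ≈ φ y) →
      ΣR (map (λ s → φ (inv s)) S) ≈ ΣR (map φ S)
    sum-over-inverses φ φ-cong = begin
      ΣR (map (λ s → φ (inv s)) S)  ≡⟨ ≡.cong ΣR (map-∘ S) ⟩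
      ΣR (map φ (map inv S))        ≈⟨ sumOf-sameElements φ φ-cong (map inv S) S inverses-distinct distinct inverses⊆S S⊆inverses ⟩
      ΣR (map φ S)                  ∎
      where
      inverses-distinct : Distinct (map inv S)
      inverses-distinct = UniqueProps.map⁺ Grp.setoid Grp.setoid ⁻¹-injective distinct

  conv-hker : ∀ S {g : G → K} → (∀ {x y} → x ≈G y → g x ≈ g y) → ∀ x →
    conv (hker S) g x ≈ natR (length S) * g x + - ΣR (map (λ s → g (x · inv s)) S)
  conv-hker S {g} g-cong x = +-cong (*-congˡ (g-cong (x·e⁻¹≈x x))) (conv-neighbours S)
    where
    conv-neighbours : ∀ T → conv (map (λ s → (s , - 1#)) T) g x ≈ - ΣR (map (λ s → g (x · inv s)) T)
    conv-neighbours []      = sym -0#≈0#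
    conv-neighbours (s ∷ T) = trans (+-cong (-1*x≈-x _) (conv-neighbours T)) (-‿+-comm _ _)

  Δ≈conv-hker : ∀ S → Distinct S → Symmetric S → ∀ {g : G → K} → (∀ {x y} → x ≈G y → g x ≈ g y) →
    ∀ x → Δ S g x ≈ conv (hker S) g x
  Δ≈conv-hker S distinct symmetric {g} g-cong x = sym (trans (conv-hker S g-cong x)
    (+-congˡ (-‿cong (sum-over-inverses (λ s → g (x · s)) (λ s≈t → g-cong (Grp.∙-congˡ s≈t))))))
    where open SymmetricSet S distinct symmetric

  Δ-ext : ∀ S {g g′ : G → K} → (∀ y → g y ≈ g′ y) → ∀ x → Δ S g x ≈ Δ S g′ x
  Δ-ext S g≈g′ x = +-cong (*-congˡ (g≈g′ x)) (-‿cong (ΣR-cong S (λ s → g≈g′ (x · s))))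

  binom : ℕ → ℕ → K
  binom n i = sgn i * natR (n C i)

  binom-pascal : ∀ n i t → binom (suc n) (suc i) * t ≈ binom n (suc i) * t + - (binom n i * t)
  binom-pascal n i t = begin
    (- sgn i * natR (suc n C suc i)) * t                     ≈⟨ *-congʳ (*-congˡ pascal) ⟩
    (- sgn i * (natR (n C i) + natR (n C suc i))) * t        ≈⟨ *-congʳ (distribˡ (- sgn i) _ _) ⟩
    (- sgn i * natR (n C i) + - sgn i * natR (n C suc i)) * t ≈⟨ distribʳ t _ _ ⟩
    (- sgn i * natR (n C i)) * t + binom n (suc i) * t       ≈⟨ +-comm _ _ ⟩
    binom n (suc i) * t + (- sgn i * natR (n C i)) * t       ≈⟨ +-congˡ (*-congʳ (-‿distribˡ-* (sgn i) _)) ⟨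
    binom n (suc i) * t + - binom n i * t                    ≈⟨ +-congˡ (-‿distribˡ-* (binom n i) t) ⟨
    binom n (suc i) * t + - (binom n i * t)                  ∎
    where
    pascal : natR (suc n C suc i) ≈ natR (n C i) + natR (n C suc i)
    pascal = trans (reflexive (≡.cong natR (≡.sym (nCk+nC[k+1]≡[n+1]C[k+1] n i)))) (natR-+ (n C i) (n C suc i))

  -- With T g = h * g, the kernel K_n acts as (1 - T)ⁿ = Σᵢ (-1)ⁱ C(n,i) Tⁱ.
  module BinomialExpansion (S : List G) (f : G → K) (f-cong : ∀ {x y} → x ≈G y → f x ≈ f y) where

    T : (G → K) → G → K
    T = conv (hker S)

    Tpow : ℕ → G → K
    Tpow zero    = f
    Tpow (suc j) = T (Tpow j)

    conv-hpow : ∀ j x → conv (hpow S j) f x ≈ Tpow j x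
    conv-hpow zero          x = conv-δe f-cong x
    conv-hpow (suc zero)    x = refl
    conv-hpow (suc (suc j)) x =
      trans (conv-⊛ f-cong (hker S) (hpow S (suc j)) x) (conv-ext (hker S) (λ y → conv-hpow (suc j) y) x)

    binomialSum : ℕ → G → K
    binomialSum n x = sumTo (suc n) (λ i → binom n i * Tpow i x)

    conv-Kn : ∀ n x → conv (Kn S n) f x ≈ binomialSum n x
    conv-Kn n x = begin
      conv (δe ++ concatMap term (upTo n)) f x
        ≈⟨ conv-++ δe (concatMap term (upTo n)) f x ⟩
      conv δe f x + conv (concatMap term (upTo n)) f x
        ≈⟨ +-cong (conv-δe f-cong x) (conv-concatMap term (upTo n) f x) ⟩
      f x + ΣR (map (λ i → conv (term i) f x) (upTo n))
        ≈⟨ +-cong leading (ΣR-cong (upTo n) (λ i → trans (conv-scale _ (hpow S (suc i)) f x) (*-congˡ (conv-hpow (suc i) x)))) ⟩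
      binom n 0 * f x + ΣR (map (λ i → binom n (suc i) * Tpow (suc i) x) (upTo n))
        ≡⟨ ≡.cong (λ l → binom n 0 * f x + ΣR l) (map-applyUpTo (λ i → binom n (suc i) * Tpow (suc i) x) id n) ⟩
      binomialSum n x ∎
      where
      term : ℕ → FinSupp
      term i = scale (sgn (suc i) * natR (n C suc i)) (hpow S (suc i))
      leading : f x ≈ binom n 0 * f x
      leading = sym (trans (*-congʳ (trans (*-identityˡ _) (+-identityʳ 1#))) (*-identityˡ (f x)))

    -- (1 - T)ⁿ⁺¹ = (1 - T)ⁿ - T (1 - T)ⁿ, by Pascal's rule and C(n,n+1) = 0.
    binomialSum-step : ∀ n x → binomialSum (suc n) x ≈ binomialSum n x + - T (binomialSum n) x
    binomialSum-step n x = begin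
      c₀ + sumTo (suc n) (λ i → binom (suc n) (suc i) * Tpow (suc i) x)
        ≈⟨ +-congˡ (sumTo-cong (suc n) (λ i → binom-pascal n i (Tpow (suc i) x))) ⟩
      c₀ + sumTo (suc n) (λ i → A i + - B i)
        ≈⟨ +-congˡ (sumTo-sub (suc n) A B) ⟩
      c₀ + (sumTo (suc n) A + - sumTo (suc n) B)
        ≈⟨ +-congˡ (+-congʳ (trans (sumTo-last n A) (trans (+-congˡ last-vanishes) (+-identityʳ _)))) ⟩
      c₀ + (sumTo n A + - sumTo (suc n) B)
        ≈⟨ +-assoc c₀ _ _ ⟨
      binomialSum n x + - sumTo (suc n) B
        ≈⟨ +-congˡ (-‿cong (conv-linear (hker S) (suc n) (binom n) Tpow x)) ⟨
      binomialSum n x + - T (binomialSum n) x ∎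
      where
      c₀ = binom (suc n) 0 * f x
      A B : ℕ → K
      A i = binom n (suc i) * Tpow (suc i) x
      B i = binom n i * Tpow (suc i) x
      last-vanishes : A n ≈ 0#
      last-vanishes = begin
        (sgn (suc n) * natR (n C suc n)) * Tpow (suc n) x ≡⟨ ≡.cong (λ k → (sgn (suc n) * natR k) * Tpow (suc n) x) (k>n⇒nCk≡0 (n<1+n n)) ⟩
        (sgn (suc n) * 0#) * Tpow (suc n) x              ≈⟨ trans (*-congʳ (zeroʳ _)) (zeroˡ _) ⟩
        0#                                               ∎

    Kn-step : ∀ n x → conv (Kn S (suc n)) f x ≈ conv (Kn S n) f x + - T (conv (Kn S n) f) x
    Kn-step n x = begin
      conv (Kn S (suc n)) f x                  ≈⟨ conv-Kn (suc n) x ⟩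
      binomialSum (suc n) x                    ≈⟨ binomialSum-step n x ⟩
      binomialSum n x + - T (binomialSum n) x  ≈⟨ +-cong (conv-Kn n x) (-‿cong (conv-ext (hker S) (conv-Kn n) x)) ⟨
      conv (Kn S n) f x + - T (conv (Kn S n) f) x ∎

  heat-kernel-step : ∀ S → Distinct S → Symmetric S → ∀ f → (∀ {x y} → x ≈G y → f x ≈ f y) →
    ∀ n x → conv (Kn S (suc n)) f x ≈ conv (Kn S n) f x + - Δ S (conv (Kn S n) f) x
  heat-kernel-step S distinct symmetric f f-cong n x =
    trans (Kn-step n x) (+-congˡ (-‿cong (sym (Δ≈conv-hker S distinct symmetric (conv-resp (Kn S n) f-cong) x))))
    where open BinomialExpansion S f f-cong

theorem2p1 : {a b c d : Level} (Γ : AbelianGroup a b) (R : CommutativeRing c d) →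
    let open HeatDefs Γ R in
    Infinite → (S : List G) → Distinct S → NoIdentity S → Generates S → Symmetric S →
    (f : G → K) → (∀ {x y} → x ≈G y → f x ≈R f y) →
    (u : G → ℕ → K) →
    IsHeatSolution S f u ⇔ ((x : G) (n : ℕ) → u x n ≈R conv (Kn S n) f x)
theorem2p1 Γ R _ S distinct _ _ symmetric f f-cong u = solves⇔V u
  where
  open HeatEquation Γ R
  open HeatDefs Γ R using (Δ; Kn; conv)
  open DifferenceEquation (Δ S) (Δ-ext S) f (λ n → conv (Kn S n) f)
         (conv-δe f-cong) (heat-kernel-step S distinct symmetric f f-cong)
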